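{- Let $z\in\mathcal{F}_\infty$. If $v,w\in\mathcal{A}_{\mathrm{FPF}}(z)$ and $v<_{\mathcal{A}_{\mathrm{FPF}}}w$, then $\lambda(v)<\lambda(w)$ in the dominance order.
   Context: Let $S_\mathbb{Z}$ be the finitely supported permutations of $\mathbb{Z}$, $S_\infty$ those with support in $\mathbb{P}$, $\ell$ the length, $\Theta(i)=i-(-1)^i$, $\mathcal{F}_\infty=\{w^{ -1}\Theta w:w\in S_\infty\}$; for $z\in\mathcal{F}_\infty$, $\mathcal{A}_{\mathrm{FPF}}(z)$ is the set of minimal-length $w\in S_\mathbb{Z}$ with $z=w^{ -1}\Theta w$ (these lie in $S_\infty$). For $w\in S_\infty$ the code is $c(w)=(c_1,c_2,\dots)$ with $c_i=|\{j>i: w(j)<w(i)\}|$, and the shape $\lambda(w)$ is the partition obtained by sorting $c(w)$ into weakly decreasing order. The relation $<_{\mathcal{A}_{\mathrm{FPF}}}$ on $S_\infty$ is the transitive closure of: $v<_{\mathcal{A}_{\mathrm{FPF}}}w$ when the one-line representation of $v^{ -1}$ can be transformed into that of $w^{ -1}$ by replacing a consecutive subsequence, starting at an odd index, of the form $adbc$ with $a<b<c<d$ by $bcad$. $<$ is the strict dominance order on partitions. -}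

module Defs where

open import Data.Nat as ℕ using (ℕ; zero; suc)
import Data.Nat.Properties as ℕP
open import Data.Nat.DivMod using (_%_)
open import Data.Integer as ℤ using (ℤ; +_; ∣_∣)
import Data.Integer.Properties as ℤP
open import Data.List using (List; []; _∷_; map; upTo; take; reverse; filter; length)
open import Data.List.Sort ℕP.≤-decTotalOrder using (sort)
open import Data.Product using (Σ; _×_; ∃)
import Data.Product
import Data.Sum
import Data.List
open import Data.Nat.ListAction using (sum)
open import Relation.Binary.PropositionalEquality using (_≡_)
open import Relation.Nullary using (¬_)
open import Relation.Nullary.Decidable using (⌊_⌋; _×-dec_)
open import Relation.Binary.Construct.Closure.Transitive using (TransClosure)

-- Finitely supported permutations of ℤ  (the group S_ℤ).
-- `bound` is a witness that the support lies in [-bound, bound].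

record Perm : Set where
  field
    fun   : ℤ → ℤ
    inv   : ℤ → ℤ
    inv-l : ∀ i → inv (fun i) ≡ i
    inv-r : ∀ i → fun (inv i) ≡ i
    bound : ℕ
    supp  : ∀ i → bound ℕ.< ∣ i ∣ → fun i ≡ i
open Perm public

InS∞ : Perm → Set
InS∞ w = ∀ i → i ℤ.≤ + 0 → fun w i ≡ i

range : ℕ → List ℤ
range N = map (λ k → (+ k) ℤ.- (+ N)) (upTo (suc (2 ℕ.* N)))

-- length ℓ(w) = number of inversions (i < j, w(i) > w(j)); all inversions
-- lie inside the support bound.
len : Perm → ℕ
len w = length (filter (λ p → ℤ._<?_ (Data.Product.proj₁ p) (Data.Product.proj₂ p)
                              ×-dec ℤ._<?_ (fun w (Data.Product.proj₂ p)) (fun w (Data.Product.proj₁ p)))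
                       (Data.List.cartesianProduct (range (bound w)) (range (bound w))))

-- Θ(i) = i - (-1)^i
Θ : ℤ → ℤ
Θ i with ∣ i ∣ % 2
... | zero  = i ℤ.- + 1
... | suc _ = i ℤ.+ + 1

IsFPFRep : (ℤ → ℤ) → Perm → Set
IsFPFRep z w = ∀ i → inv w (Θ (fun w i)) ≡ z i

InF∞ : (ℤ → ℤ) → Set
InF∞ z = Σ Perm λ w → InS∞ w × IsFPFRep z w

InAFPF : (ℤ → ℤ) → Perm → Set
InAFPF z w = IsFPFRep z w × (∀ u → IsFPFRep z u → len w ℕ.≤ len u)

-- c_i(w) = #{ j > i : w(j) < w(i) }, for i ≥ 1 (j beyond the bound never counts)
codeEntry : Perm → ℕ → ℕ
codeEntry w i = length (filter (λ j → ℤ._<?_ (fun w (+ j)) (fun w (+ i)))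
                               (map (λ k → suc i ℕ.+ k) (upTo (bound w ℕ.∸ i))))

-- (c_1, ..., c_bound); all later entries are 0
code : Perm → List ℕ
code w = map (λ k → codeEntry w (suc k)) (upTo (bound w))

shape : Perm → List ℕ
shape w = reverse (sort (code w))

-- strict dominance order on partitions (lists, trailing zeros irrelevant)
psum : ℕ → List ℕ → ℕ
psum k λ′ = sum (take k λ′)

_◁_ : List ℕ → List ℕ → Set
λ′ ◁ μ = (sum λ′ ≡ sum μ) × (∀ k → psum k λ′ ℕ.≤ psum k μ) × ∃ λ k → psum k λ′ ℕ.< psum k μ

-- v ⋖ w : the one-line word of v⁻¹ becomes that of w⁻¹ by replacing the
-- consecutive subword a d b c (a<b<c<d) at positions p,p+1,p+2,p+3
-- (p = 2m+1 odd) by b c a d.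
Step : Perm → Perm → Set
Step v w = InS∞ v × InS∞ w × ∃ λ (m : ℕ) →
  let p = + (suc (2 ℕ.* m))
      a = inv v p ; d = inv v (p ℤ.+ + 1)
      b = inv v (p ℤ.+ + 2) ; c = inv v (p ℤ.+ + 3)
  in (a ℤ.< b) × (b ℤ.< c) × (c ℤ.< d)
     × (inv w p ≡ b) × (inv w (p ℤ.+ + 1) ≡ c)
     × (inv w (p ℤ.+ + 2) ≡ a) × (inv w (p ℤ.+ + 3) ≡ d)
     × (∀ j → (j ℤ.< p) Data.Sum.⊎ (p ℤ.+ + 3 ℤ.< j) → inv w j ≡ inv v j)

_<AFPF_ : Perm → Perm → Set
_<AFPF_ = TransClosure Step

-- In a step v ⋖ w the entries p, …, p + 3 of v⁻¹ change from a d b c to b c a d. These are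
-- consecutive values, so comparisons with any other value are unaffected and the code changes
-- only at a, b, c: c_a grows by 2 while c_b and c_c drop by 1. Moreover c_b, c_c ≤ c_a + 1 in v,
-- since an entry after b or c lying below v(b) or v(c) lies below v(a) = p or is at d.
-- Partial sums of a decreasing sequence λ are psum k λ = Σ_t min(k, λ′_{t+1}) with λ′ the
-- conjugate; moving one unit from a part s + 1 to a part r ≥ s changes λ′ only at s and r, which
-- lowers no partial sum and, when r > s, raises one strictly. The code change is two such moves
-- (c → a, then b → a), so λ(v) < λ(w) for each step and hence along <_{𝒜_FPF}.

module Submission where

open import Defs
open import Data.Integer using (ℤ)
open import Data.Integer as ℤ using (-[1+_]; +<+; +≤+; -<+; -≤+)
import Data.Integer.Properties as ℤP

open import Data.Nat as ℕ using (ℕ; zero; suc; _+_; _*_; _∸_; _⊓_; _≤_; _<_; _≥_; z≤n; s≤s; _≤?_; _<?_; _≟_)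
open import Data.Nat.Properties
open import Data.List using (List; []; _∷_; map; upTo; applyUpTo; filter; length; reverse)
import Data.List.Properties as List
open import Data.List.Relation.Unary.All using (All; []; _∷_)
import Data.List.Relation.Unary.All as All
import Data.List.Relation.Unary.All.Properties as All
open import Data.List.Relation.Unary.AllPairs using (AllPairs; []; _∷_)
import Data.List.Relation.Unary.AllPairs.Properties as AllPairs
open import Data.List.Relation.Unary.Linked.Properties using (Linked⇒AllPairs)
open import Data.List.Relation.Binary.Permutation.Propositional using (_↭_; ↭-trans; ↭-sym)
open import Data.List.Relation.Binary.Permutation.Propositional.Properties
  using (filter-↭; ↭-length; ↭-reverse; All-resp-↭)
open import Data.List.Sort ≤-decTotalOrder using (sort; sort-↭; sort-↗)
open import Data.Nat.ListAction using (sum)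
open import Data.Nat.ListAction.Properties using (sum-↭)
open import Data.Empty using (⊥; ⊥-elim)
open import Data.Sum using (_⊎_; inj₁; inj₂)
open import Data.Product using (Σ-syntax; ∃; _×_; _,_; proj₂)
open import Function using (_∘_; flip)
open import Relation.Binary.Construct.Closure.Transitive using ([_]; _∷_)
open import Relation.Nullary using (Dec; yes; no; ¬_)
open import Relation.Binary.Definitions using (tri<; tri≈; tri>)
open import Data.Nat.Solver using (module +-*-Solver)
open +-*-Solver using (solve; _:+_; _:=_)
open import Relation.Binary.PropositionalEquality
open import Algebra.Properties.CommutativeSemigroup +-commutativeSemigroup using (interchange; xy∙z≈xz∙y; xy∙z≈zy∙x)
open import Algebra.Properties.AbelianGroup ℤP.+-0-abelianGroup using (xyx⁻¹≈y)

𝟙 : {P : Set} → Dec P → ℕ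
𝟙 (yes _) = 1
𝟙 (no _)  = 0

𝟙-yes : {P : Set} → P → (d : Dec P) → 𝟙 d ≡ 1
𝟙-yes p (yes _) = refl
𝟙-yes p (no ¬p) = ⊥-elim (¬p p)

𝟙-no : {P : Set} → ¬ P → (d : Dec P) → 𝟙 d ≡ 0
𝟙-no ¬p (yes p) = ⊥-elim (¬p p)
𝟙-no ¬p (no _)  = refl

𝟙-mono : {P Q : Set} → (P → Q) → (d : Dec P) (e : Dec Q) → 𝟙 d ≤ 𝟙 e
𝟙-mono f (yes p) e = ≤-reflexive (sym (𝟙-yes (f p) e))
𝟙-mono f (no _)  _ = z≤n

𝟙-cong : {P Q : Set} → (P → Q) → (Q → P) → (d : Dec P) (e : Dec Q) → 𝟙 d ≡ 𝟙 e
𝟙-cong f g d e = ≤-antisym (𝟙-mono f d e) (𝟙-mono g e d)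

δ : ℕ → ℕ → ℕ
δ a b = 𝟙 (a ≟ b)

δ-refl : ∀ a → δ a a ≡ 1
δ-refl a = 𝟙-yes refl (a ≟ a)

δ-≢ : ∀ {a b} → a ≢ b → δ a b ≡ 0
δ-≢ {a} {b} a≢b = 𝟙-no a≢b (a ≟ b)

∑ : ℕ → (ℕ → ℕ) → ℕ
∑ zero    f = 0
∑ (suc n) f = f 0 + ∑ n (f ∘ suc)

infix 5 ∑
syntax ∑ n (λ k → e) = ∑[ k < n ] e

∑-cong : ∀ n {f g : ℕ → ℕ} → (∀ k → k < n → f k ≡ g k) → ∑ n f ≡ ∑ n g
∑-cong zero    eq = refl
∑-cong (suc n) eq = cong₂ _+_ (eq 0 (s≤s z≤n)) (∑-cong n (λ k k<n → eq (suc k) (s≤s k<n)))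

∑-mono-≤ : ∀ n {f g : ℕ → ℕ} → (∀ k → k < n → f k ≤ g k) → ∑ n f ≤ ∑ n g
∑-mono-≤ zero    le = z≤n
∑-mono-≤ (suc n) le = +-mono-≤ (le 0 (s≤s z≤n)) (∑-mono-≤ n (λ k k<n → le (suc k) (s≤s k<n)))

∑-distrib-+ : ∀ n (f g : ℕ → ℕ) → ∑[ k < n ] (f k + g k) ≡ ∑ n f + ∑ n g
∑-distrib-+ zero    f g = refl
∑-distrib-+ (suc n) f g
  rewrite ∑-distrib-+ n (f ∘ suc) (g ∘ suc) = interchange (f 0) (g 0) (∑ n (f ∘ suc)) (∑ n (g ∘ suc))

∑-zero : ∀ n {f : ℕ → ℕ} → (∀ k → k < n → f k ≡ 0) → ∑ n f ≡ 0
∑-zero zero    eq = refl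
∑-zero (suc n) eq rewrite eq 0 (s≤s z≤n) = ∑-zero n (λ k k<n → eq (suc k) (s≤s k<n))

∑-++ : ∀ m n (f : ℕ → ℕ) → ∑ (m + n) f ≡ ∑ m f + (∑[ k < n ] f (m + k))
∑-++ zero    n f = refl
∑-++ (suc m) n f rewrite ∑-++ m n (f ∘ suc) = sym (+-assoc (f 0) _ _)

∑-trailing-zeros : ∀ {m n} (f : ℕ → ℕ) → m ≤ n → (∀ k → m ≤ k → f k ≡ 0) → ∑ n f ≡ ∑ m f
∑-trailing-zeros {m} f m≤n zeros with m≤n⇒∃[o]m+o≡n m≤n
... | o , refl = begin
  ∑ (m + o) f                    ≡⟨ ∑-++ m o f ⟩
  ∑ m f + (∑[ k < o ] f (m + k))   ≡⟨ cong (∑ m f +_) (∑-zero o (λ k _ → zeros (m + k) (m≤m+n m k))) ⟩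
  ∑ m f + 0                      ≡⟨ +-identityʳ _ ⟩
  ∑ m f                          ∎
  where open ≡-Reasoning

∑-δ : ∀ {x n} → x < n → ∑[ k < n ] δ k x ≡ 1
∑-δ {zero}  {suc n} _ = cong suc (∑-zero n (λ k _ → δ-≢ {suc k} {0} λ ()))
∑-δ {suc x} {suc n} (s≤s x<n) =
  trans (∑-cong n (λ k _ → 𝟙-cong suc-injective (cong suc) (suc k ≟ suc x) (k ≟ x))) (∑-δ x<n)

∑-+-δ : ∀ {x} n {f g : ℕ → ℕ} → x < n → (∀ k → f k ≡ g k + δ k x) → ∑ n f ≡ ∑ n g + 1
∑-+-δ n {f} {g} x<n eq =
  trans (∑-cong n (λ k _ → eq k)) (trans (∑-distrib-+ n g _) (cong (∑ n g +_) (∑-δ x<n)))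

∑-≤-+-δ : ∀ {x} n {f g : ℕ → ℕ} → x < n → (∀ k → f k ≤ g k + δ k x) → ∑ n f ≤ ∑ n g + 1
∑-≤-+-δ n {f} {g} x<n le =
  ≤-trans (∑-mono-≤ n (λ k _ → le k)) (≤-reflexive (trans (∑-distrib-+ n g _) (cong (∑ n g +_) (∑-δ x<n))))

∑-update : ∀ {x} n {f g : ℕ → ℕ} → x < n → (∀ z → z ≢ x → f z ≡ g z) →
           ∑ n f + g x ≡ ∑ n g + f x
∑-update {zero} (suc n) {f} {g} _ agree
  rewrite ∑-cong n {f ∘ suc} {g ∘ suc} (λ k _ → agree (suc k) λ ()) = xy∙z≈zy∙x (f 0) _ (g 0)
∑-update {suc x} (suc n) {f} {g} (s≤s x<n) agree rewrite agree 0 λ () = begin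
  g 0 + ∑ n (f ∘ suc) + g (suc x)     ≡⟨ +-assoc (g 0) _ _ ⟩
  g 0 + (∑ n (f ∘ suc) + g (suc x))   ≡⟨ cong (g 0 +_) (∑-update n x<n (λ z → agree (suc z) ∘ (_∘ suc-injective))) ⟩
  g 0 + (∑ n (g ∘ suc) + f (suc x))   ≡⟨ +-assoc (g 0) _ _ ⟨
  g 0 + ∑ n (g ∘ suc) + f (suc x)     ∎
  where open ≡-Reasoning

∑-update₂ : ∀ {x y} n {f g : ℕ → ℕ} → x < n → y < n → x ≢ y →
            (∀ z → z ≢ x → z ≢ y → f z ≡ g z) →
            ∑ n f + g x + g y ≡ ∑ n g + f x + f y
∑-update₂ {x} {y} n {f} {g} x<n y<n x≢y agree = begin
  ∑ n f + g x + g y   ≡⟨ cong (λ t → ∑ n f + t + g y) (sym hx) ⟩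
  ∑ n f + h x + g y   ≡⟨ cong (_+ g y) (∑-update n x<n f≗h) ⟩
  ∑ n h + f x + g y   ≡⟨ xy∙z≈xz∙y (∑ n h) _ _ ⟩
  ∑ n h + g y + f x   ≡⟨ cong (_+ f x) (∑-update n y<n h≗g) ⟩
  ∑ n g + h y + f x   ≡⟨ cong (λ t → ∑ n g + t + f x) hy ⟩
  ∑ n g + f y + f x   ≡⟨ xy∙z≈xz∙y (∑ n g) _ _ ⟩
  ∑ n g + f x + f y   ∎
  where
  open ≡-Reasoning
  h : ℕ → ℕ
  h z with z ≟ x
  ... | yes _ = g z
  ... | no  _ = f z
  hx : h x ≡ g x
  hx with x ≟ x
  ... | yes _   = refl
  ... | no x≢x = ⊥-elim (x≢x refl)
  hy : h y ≡ f y
  hy with y ≟ x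
  ... | yes y≡x = ⊥-elim (x≢y (sym y≡x))
  ... | no  _   = refl
  f≗h : ∀ z → z ≢ x → f z ≡ h z
  f≗h z z≢x with z ≟ x
  ... | yes z≡x = ⊥-elim (z≢x z≡x)
  ... | no  _   = refl
  h≗g : ∀ z → z ≢ y → h z ≡ g z
  h≗g z z≢y with z ≟ x
  ... | yes _   = refl
  ... | no  z≢x = agree z z≢x z≢y

AllPairs-reverse : {A : Set} {R : A → A → Set} {xs : List A} →
                   AllPairs R xs → AllPairs (flip R) (reverse xs)
AllPairs-reverse [] = []
AllPairs-reverse {xs = x ∷ xs} (Rx ∷ Rxs) rewrite List.unfold-reverse x xs =
  AllPairs.++⁺ (AllPairs-reverse Rxs) ([] ∷ [])
               (All.map (_∷ []) (All-resp-↭ (↭-sym (↭-reverse xs)) Rx))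

sortDesc : List ℕ → List ℕ
sortDesc l = reverse (sort l)

sortDesc-↭ : ∀ l → sortDesc l ↭ l
sortDesc-↭ l = ↭-trans (↭-reverse (sort l)) (sort-↭ l)

sortDesc-desc : ∀ l → AllPairs _≥_ (sortDesc l)
sortDesc-desc l = AllPairs-reverse (Linked⇒AllPairs ≤-trans (sort-↗ l))

parts> : ℕ → List ℕ → ℕ
parts> t l = length (filter (t <?_) l)

parts>-↭ : ∀ t {l l′} → l ↭ l′ → parts> t l ≡ parts> t l′
parts>-↭ t l↭l′ = ↭-length (filter-↭ (t <?_) l↭l′)

length-filter-∷ : {P : ℕ → Set} (P? : ∀ x → Dec (P x)) (x : ℕ) (l : List ℕ) →
                  length (filter P? (x ∷ l)) ≡ 𝟙 (P? x) + length (filter P? l)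
length-filter-∷ P? x l with P? x
... | yes _ = refl
... | no  _ = refl

parts>-∷ : ∀ t x l → parts> t (x ∷ l) ≡ 𝟙 (t <? x) + parts> t l
parts>-∷ t = length-filter-∷ (t <?_)

parts>-≤ : ∀ {t l} → All (_≤ t) l → parts> t l ≡ 0
parts>-≤ []                          = refl
parts>-≤ {t} {x ∷ l} (x≤t ∷ l≤t) = trans (parts>-∷ t x l)
  (cong₂ _+_ (𝟙-no (≤⇒≯ x≤t) (t <? x)) (parts>-≤ l≤t))

∑-𝟙-< : ∀ {x T} → x ≤ T → ∑[ t < T ] 𝟙 (t <? x) ≡ x
∑-𝟙-< {zero}  {T}     _         = ∑-zero T (λ t _ → 𝟙-no (λ ()) (t <? 0))
∑-𝟙-< {suc x} {suc T} (s≤s x≤T) = cong suc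
  (trans (∑-cong T (λ t _ → 𝟙-cong ℕ.s<s⁻¹ ℕ.s<s (suc t <? suc x) (t <? x))) (∑-𝟙-< x≤T))

⊓-parts>-∷ : ∀ k t {x l} → All (_≤ x) l →
             suc k ⊓ parts> t (x ∷ l) ≡ 𝟙 (t <? x) + k ⊓ parts> t l
⊓-parts>-∷ k t {x} {l} l≤x rewrite parts>-∷ t x l with t <? x
... | yes _   = refl
... | no  t≮x rewrite parts>-≤ (All.map (λ y≤x → ≤-trans y≤x (≮⇒≥ t≮x)) l≤x) | ⊓-zeroʳ k = refl

psum-conjugate : ∀ T {l} → All (_≤ T) l → AllPairs _≥_ l →
                 ∀ k → psum k l ≡ ∑[ t < T ] k ⊓ parts> t l
psum-conjugate T {l}     _ _ zero    = sym (∑-zero T (λ _ _ → refl))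
psum-conjugate T {[]}    _ _ (suc k) = sym (∑-zero T (λ _ _ → refl))
psum-conjugate T {x ∷ l} (x≤T ∷ l≤T) (l≤x ∷ desc) (suc k) = begin
  x + psum k l
    ≡⟨ cong₂ _+_ (sym (∑-𝟙-< x≤T)) (psum-conjugate T l≤T desc k) ⟩
  (∑[ t < T ] 𝟙 (t <? x)) + (∑[ t < T ] k ⊓ parts> t l)
    ≡⟨ ∑-distrib-+ T _ _ ⟨
  ∑[ t < T ] (𝟙 (t <? x) + k ⊓ parts> t l)
    ≡⟨ ∑-cong T (λ t _ → ⊓-parts>-∷ k t l≤x) ⟨
  ∑[ t < T ] suc k ⊓ parts> t (x ∷ l)
    ∎
  where open ≡-Reasoning

psum-sortDesc : ∀ T {l} → All (_≤ T) l → ∀ k → psum k (sortDesc l) ≡ ∑[ t < T ] k ⊓ parts> t l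
psum-sortDesc T {l} l≤T k =
  trans (psum-conjugate T (All-resp-↭ (↭-sym (sortDesc-↭ l)) l≤T) (sortDesc-desc l) k)
        (∑-cong T (λ t _ → cong (k ⊓_) (parts>-↭ t (sortDesc-↭ l))))

sum-sortDesc : ∀ l → sum (sortDesc l) ≡ sum l
sum-sortDesc l = sum-↭ (sortDesc-↭ l)

parts>ᶠ : ℕ → (ℕ → ℕ) → ℕ → ℕ
parts>ᶠ Z F t = ∑[ z < Z ] 𝟙 (t <? F z)

-- By psum-conjugate, this is psum k of F 0, …, F (Z ∸ 1) sorted decreasingly, provided all are at most T.
psumᶠ : ℕ → ℕ → (ℕ → ℕ) → ℕ → ℕ
psumᶠ T Z F k = ∑[ t < T ] k ⊓ parts>ᶠ Z F t

length-filter-applyUpTo : {P : ℕ → Set} (P? : ∀ x → Dec (P x)) (f : ℕ → ℕ) (n : ℕ) →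
                          length (filter P? (applyUpTo f n)) ≡ ∑[ z < n ] 𝟙 (P? (f z))
length-filter-applyUpTo P? f zero    = refl
length-filter-applyUpTo P? f (suc n) =
  trans (length-filter-∷ P? (f 0) _) (cong (𝟙 (P? (f 0)) +_) (length-filter-applyUpTo P? (f ∘ suc) n))

sum-applyUpTo : ∀ (f : ℕ → ℕ) n → sum (applyUpTo f n) ≡ ∑ n f
sum-applyUpTo f zero    = refl
sum-applyUpTo f (suc n) = cong (f 0 +_) (sum-applyUpTo (f ∘ suc) n)

module _ (F : ℕ → ℕ) {n Z : ℕ} (n≤Z : n ≤ Z) (F-tail : ∀ z → n ≤ z → F z ≡ 0) where

  sum-sortDesc-applyUpTo : sum (sortDesc (applyUpTo F n)) ≡ ∑ Z F
  sum-sortDesc-applyUpTo = begin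
    sum (sortDesc (applyUpTo F n)) ≡⟨ sum-sortDesc (applyUpTo F n) ⟩
    sum (applyUpTo F n)            ≡⟨ sum-applyUpTo F n ⟩
    ∑ n F                          ≡⟨ ∑-trailing-zeros F n≤Z F-tail ⟨
    ∑ Z F                          ∎
    where open ≡-Reasoning

  psum-sortDesc-applyUpTo : ∀ {T} → (∀ z → F z ≤ T) →
                            ∀ k → psum k (sortDesc (applyUpTo F n)) ≡ psumᶠ T Z F k
  psum-sortDesc-applyUpTo {T} F≤T k =
    trans (psum-sortDesc T (All.applyUpTo⁺₂ F n F≤T) k) (∑-cong T (λ t _ → cong (k ⊓_) (parts>-applyUpTo t)))
    where
    parts>-applyUpTo : ∀ t → parts> t (applyUpTo F n) ≡ parts>ᶠ Z F t
    parts>-applyUpTo t = trans (length-filter-applyUpTo (t <?_) F n)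
      (sym (∑-trailing-zeros _ n≤Z (λ z n≤z → 𝟙-no (n≮0 ∘ subst (t <_) (F-tail z n≤z)) (t <? F z))))

𝟙-<-suc : ∀ t u → 𝟙 (t <? suc u) ≡ 𝟙 (t <? u) + δ t u
𝟙-<-suc t u with <-cmp t u
... | tri< t<u _ _ rewrite 𝟙-yes (m≤n⇒m≤1+n t<u) (t <? suc u) | 𝟙-yes t<u (t <? u) | δ-≢ (<⇒≢ t<u) = refl
... | tri≈ _ refl _ rewrite 𝟙-yes ≤-refl (t <? suc t) | 𝟙-no (<-irrefl refl) (t <? t) | δ-refl t = refl
... | tri> _ _ u<t rewrite 𝟙-no (<⇒≱ u<t ∘ ℕ.s≤s⁻¹) (t <? suc u) | 𝟙-no (<-asym u<t) (t <? u) | δ-≢ (>⇒≢ u<t) = refl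

+-cancel-middle : ∀ m n a b c d → m + a + (b + c) ≡ n + (a + d) + b → m + c ≡ n + d
+-cancel-middle m n a b c d eq = +-cancelʳ-≡ (a + b) _ _ (trans (lhs m a b c) (trans eq (rhs n a d b)))
  where
  lhs : ∀ m a b c → m + c + (a + b) ≡ m + a + (b + c)
  lhs = solve 4 (λ m a b c → m :+ c :+ (a :+ b) := m :+ a :+ (b :+ c)) refl
  rhs : ∀ n a d b → n + (a + d) + b ≡ n + d + (a + b)
  rhs = solve 4 (λ n a d b → n :+ (a :+ d) :+ b := n :+ d :+ (a :+ b)) refl

⊓-suc : ∀ k n → k ⊓ suc n ≡ k ⊓ n + 𝟙 (n <? k)
⊓-suc zero    n       = refl
⊓-suc (suc k) zero    = cong suc (⊓-zeroʳ k)
⊓-suc (suc k) (suc n) =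
  cong suc (trans (⊓-suc k n) (cong (k ⊓ n +_) (𝟙-cong ℕ.s<s ℕ.s<s⁻¹ (n <? k) (suc n <? suc k))))

module UnitTransfer {T Z x y : ℕ} {F G : ℕ → ℕ}
  (x<Z : x < Z) (y<Z : y < Z) (x≢y : x ≢ y) (agree : ∀ z → z ≢ x → z ≢ y → F z ≡ G z)
  (Fx≡1+Gx : F x ≡ suc (G x)) (Gy≡1+Fy : G y ≡ suc (F y)) (Fy<T : F y < T) where

  private
    s r : ℕ
    s = G x
    r = F y
    NF NG : ℕ → ℕ
    NF = parts>ᶠ Z F
    NG = parts>ᶠ Z G

  ∑-transfer : ∑ Z G ≡ ∑ Z F
  ∑-transfer = +-cancelʳ-≡ (suc (s + r)) _ _ (begin
    ∑ Z G + suc (s + r)     ≡⟨ +-assoc (∑ Z G) (suc s) r ⟨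
    ∑ Z G + suc s + r       ≡⟨ cong (λ u → ∑ Z G + u + r) Fx≡1+Gx ⟨
    ∑ Z G + F x + F y       ≡⟨ ∑-update₂ Z x<Z y<Z x≢y (λ z z≢x z≢y → sym (agree z z≢x z≢y)) ⟩
    ∑ Z F + s + G y         ≡⟨ cong (∑ Z F + s +_) Gy≡1+Fy ⟩
    ∑ Z F + s + suc r       ≡⟨ +-assoc (∑ Z F) s (suc r) ⟩
    ∑ Z F + (s + suc r)     ≡⟨ cong (∑ Z F +_) (+-suc s r) ⟩
    ∑ Z F + suc (s + r)     ∎)
    where open ≡-Reasoning

  -- Only the threshold t = s loses the part at x, and only t = r gains the part at y.
  parts>-transfer : ∀ t → NF t + δ t r ≡ NG t + δ t s
  parts>-transfer t = +-cancel-middle (NF t) (NG t) a b (δ t r) (δ t s) (begin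
    NF t + a + (b + δ t r)          ≡⟨ cong (λ u → NF t + a + u) (𝟙-<-suc t r) ⟨
    NF t + a + 𝟙 (t <? suc r)       ≡⟨ cong (λ u → NF t + a + 𝟙 (t <? u)) Gy≡1+Fy ⟨
    NF t + a + 𝟙 (t <? G y)         ≡⟨ ∑-update₂ Z x<Z y<Z x≢y (λ z z≢x → cong (λ u → 𝟙 (t <? u)) ∘ agree z z≢x) ⟩
    NG t + 𝟙 (t <? F x) + b         ≡⟨ cong (λ u → NG t + 𝟙 (t <? u) + b) Fx≡1+Gx ⟩
    NG t + 𝟙 (t <? suc s) + b       ≡⟨ cong (λ u → NG t + u + b) (𝟙-<-suc t s) ⟩
    NG t + (a + δ t s) + b          ∎)
    where
    open ≡-Reasoning
    a b : ℕ
    a = 𝟙 (t <? s)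
    b = 𝟙 (t <? r)

  module _ (s<r : s < r) where

    parts>-off : ∀ t → t ≢ s → t ≢ r → NF t ≡ NG t
    parts>-off t t≢s t≢r = +-cancelʳ-≡ 0 _ _ (begin
      NF t + 0        ≡⟨ cong (NF t +_) (δ-≢ t≢r) ⟨
      NF t + δ t r    ≡⟨ parts>-transfer t ⟩
      NG t + δ t s    ≡⟨ cong (NG t +_) (δ-≢ t≢s) ⟩
      NG t + 0        ∎)
      where open ≡-Reasoning

    parts>-at-s : NF s ≡ suc (NG s)
    parts>-at-s = begin
      NF s            ≡⟨ +-identityʳ (NF s) ⟨
      NF s + 0        ≡⟨ cong (NF s +_) (δ-≢ (<⇒≢ s<r)) ⟨
      NF s + δ s r    ≡⟨ parts>-transfer s ⟩
      NG s + δ s s    ≡⟨ cong (NG s +_) (δ-refl s) ⟩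
      NG s + 1        ≡⟨ +-comm (NG s) 1 ⟩
      suc (NG s)      ∎
      where open ≡-Reasoning

    parts>-at-r : NG r ≡ suc (NF r)
    parts>-at-r = begin
      NG r            ≡⟨ +-identityʳ (NG r) ⟨
      NG r + 0        ≡⟨ cong (NG r +_) (δ-≢ (>⇒≢ s<r)) ⟨
      NG r + δ r s    ≡⟨ parts>-transfer r ⟨
      NF r + δ r r    ≡⟨ cong (NF r +_) (δ-refl r) ⟩
      NF r + 1        ≡⟨ +-comm (NF r) 1 ⟩
      suc (NF r)      ∎
      where open ≡-Reasoning

    -- Both x and y are counted in NF s but not in NF r.
    parts>-r<s : NF r < NG s
    parts>-r<s = ℕ.s≤s⁻¹ (begin-strict
      suc (NF r)                                                 ≡⟨ +-comm 1 (NF r) ⟩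
      NF r + 1                                                   <⟨ m<m+n (NF r + 1) ℕ.z<s ⟩
      NF r + 1 + 1                                               ≡⟨ cong₂ (λ u v → NF r + u + v) (∑-δ x<Z) (∑-δ y<Z) ⟨
      NF r + (∑[ z < Z ] δ z x) + (∑[ z < Z ] δ z y)             ≡⟨ cong (_+ _) (∑-distrib-+ Z _ _) ⟨
      (∑[ z < Z ] (𝟙 (r <? F z) + δ z x)) + (∑[ z < Z ] δ z y)   ≡⟨ ∑-distrib-+ Z _ _ ⟨
      (∑[ z < Z ] (𝟙 (r <? F z) + δ z x + δ z y))                ≤⟨ ∑-mono-≤ Z (λ z _ → pointwise z) ⟩
      NF s                                                       ≡⟨ parts>-at-s ⟩
      suc (NG s)                                                 ∎)
      where
      open ≤-Reasoning
      pointwise : ∀ z → 𝟙 (r <? F z) + δ z x + δ z y ≤ 𝟙 (s <? F z)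
      pointwise z with z ≟ x | z ≟ y
      ... | yes refl | yes refl = ⊥-elim (x≢y refl)
      ... | yes refl | no _ rewrite Fx≡1+Gx
            | 𝟙-no (<⇒≱ s<r ∘ ℕ.s≤s⁻¹) (r <? suc s) | 𝟙-yes (≤-refl {suc s}) (s <? suc s) = ≤-refl
      ... | no _ | yes refl rewrite 𝟙-no (<-irrefl refl) (r <? r) | 𝟙-yes s<r (s <? r) = ≤-refl
      ... | no _ | no _ rewrite +-identityʳ (𝟙 (r <? F z)) | +-identityʳ (𝟙 (r <? F z)) =
            𝟙-mono (<-trans s<r) (r <? F z) (s <? F z)

    psumᶠ-transfer : ∀ k → psumᶠ T Z F k + 𝟙 (NF r <? k) ≡ psumᶠ T Z G k + 𝟙 (NG s <? k)
    psumᶠ-transfer k = +-cancel-middle (psumᶠ T Z F k) (psumᶠ T Z G k) (k ⊓ NG s) (k ⊓ NF r) _ _ (begin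
      psumᶠ T Z F k + k ⊓ NG s + (k ⊓ NF r + 𝟙 (NF r <? k))
        ≡⟨ cong (λ u → psumᶠ T Z F k + k ⊓ NG s + u) (trans (cong (k ⊓_) parts>-at-r) (⊓-suc k (NF r))) ⟨
      psumᶠ T Z F k + k ⊓ NG s + k ⊓ NG r
        ≡⟨ ∑-update₂ T (<-trans s<r Fy<T) Fy<T (<⇒≢ s<r) (λ t t≢s t≢r → cong (k ⊓_) (parts>-off t t≢s t≢r)) ⟩
      psumᶠ T Z G k + k ⊓ NF s + k ⊓ NF r
        ≡⟨ cong (λ u → psumᶠ T Z G k + u + k ⊓ NF r) (trans (cong (k ⊓_) parts>-at-s) (⊓-suc k (NG s))) ⟩
      psumᶠ T Z G k + (k ⊓ NG s + 𝟙 (NG s <? k)) + k ⊓ NF r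
        ∎)
      where open ≡-Reasoning

  psumᶠ-mono : F x ≤ suc (F y) → ∀ k → psumᶠ T Z F k ≤ psumᶠ T Z G k
  psumᶠ-mono Fx≤1+Fy k with s ≟ r
  ... | yes s≡r = ≤-reflexive (∑-cong T (λ t _ → cong (k ⊓_) (parts>-equal t)))
    where
    parts>-equal : ∀ t → NF t ≡ NG t
    parts>-equal t = +-cancelʳ-≡ (δ t r) _ _ (trans (parts>-transfer t) (cong (λ u → NG t + δ t u) s≡r))
  ... | no s≢r = +-cancelʳ-≤ (𝟙 (NF r <? k)) _ _ (begin
    psumᶠ T Z F k + 𝟙 (NF r <? k)   ≡⟨ psumᶠ-transfer s<r k ⟩
    psumᶠ T Z G k + 𝟙 (NG s <? k)   ≤⟨ +-monoʳ-≤ _ (𝟙-mono (<-trans (parts>-r<s s<r)) (NG s <? k) (NF r <? k)) ⟩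
    psumᶠ T Z G k + 𝟙 (NF r <? k)   ∎)
    where
    open ≤-Reasoning
    s<r : s < r
    s<r = ≤∧≢⇒< (ℕ.s≤s⁻¹ (subst (_≤ suc r) Fx≡1+Gx Fx≤1+Fy)) s≢r

  psumᶠ-strict : F x ≤ F y → ∃ λ k → psumᶠ T Z F k < psumᶠ T Z G k
  psumᶠ-strict Fx≤Fy = k , (begin-strict
    psumᶠ T Z F k                        <⟨ m<m+n _ ℕ.z<s ⟩
    psumᶠ T Z F k + 1                    ≡⟨ cong (psumᶠ T Z F k +_) (𝟙-yes ≤-refl (NF r <? k)) ⟨
    psumᶠ T Z F k + 𝟙 (NF r <? k)        ≡⟨ psumᶠ-transfer s<r k ⟩
    psumᶠ T Z G k + 𝟙 (NG s <? k)        ≡⟨ cong (psumᶠ T Z G k +_) (𝟙-no (<⇒≱ (parts>-r<s s<r) ∘ ℕ.s≤s⁻¹) _) ⟩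
    psumᶠ T Z G k + 0                    ≡⟨ +-identityʳ _ ⟩
    psumᶠ T Z G k                        ∎)
    where
    open ≤-Reasoning
    s<r : s < r
    s<r = subst (_≤ r) Fx≡1+Gx Fx≤Fy
    k : ℕ
    k = suc (NF r)

infix 4 _◁⟨_,_⟩_
_◁⟨_,_⟩_ : (ℕ → ℕ) → ℕ → ℕ → (ℕ → ℕ) → Set
F ◁⟨ T , Z ⟩ G = (∑ Z F ≡ ∑ Z G) × (∀ k → psumᶠ T Z F k ≤ psumᶠ T Z G k)
               × ∃ λ k → psumᶠ T Z F k < psumᶠ T Z G k

-- The intermediate H receives the unit from c first; the unit from b then makes the step strict.
double-transfer : ∀ {T Z a b c} {F G : ℕ → ℕ} → a < Z → b < Z → c < Z → a ≢ b → a ≢ c → b ≢ c →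
                  (∀ z → z ≢ a → z ≢ b → z ≢ c → F z ≡ G z) →
                  G a ≡ suc (suc (F a)) → F b ≡ suc (G b) → F c ≡ suc (G c) →
                  F b ≤ suc (F a) → F c ≤ suc (F a) → suc (F a) < T → F ◁⟨ T , Z ⟩ G
double-transfer {T} {Z} {a} {b} {c} {F} {G} a<Z b<Z c<Z a≢b a≢c b≢c agree Ga Fb Fc Fb≤ Fc≤ Fa<T =
  trans (sym C→A.∑-transfer) (sym B→A.∑-transfer) ,
  (λ k → ≤-trans (C→A.psumᶠ-mono Fc≤ k) (B→A.psumᶠ-mono Hb≤1+Ha k)) ,
  strict
  where
  H : ℕ → ℕ
  H z with z ≟ a | z ≟ c
  ... | yes _ | _     = suc (F a)
  ... | no  _ | yes _ = G c
  ... | no  _ | no  _ = F z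

  Ha : H a ≡ suc (F a)
  Ha with a ≟ a
  ... | yes _   = refl
  ... | no  a≢a = ⊥-elim (a≢a refl)

  Hc : H c ≡ G c
  Hc with c ≟ a | c ≟ c
  ... | yes c≡a | _       = ⊥-elim (a≢c (sym c≡a))
  ... | no  _   | yes _   = refl
  ... | no  _   | no  c≢c = ⊥-elim (c≢c refl)

  H-off : ∀ z → z ≢ a → z ≢ c → H z ≡ F z
  H-off z z≢a z≢c with z ≟ a | z ≟ c
  ... | yes z≡a | _       = ⊥-elim (z≢a z≡a)
  ... | no  _   | yes z≡c = ⊥-elim (z≢c z≡c)
  ... | no  _   | no  _   = refl

  Hb : H b ≡ F b
  Hb = H-off b (a≢b ∘ sym) b≢c

  Hb≤Ha : H b ≤ H a
  Hb≤Ha = subst₂ _≤_ (sym Hb) (sym Ha) Fb≤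

  Hb≤1+Ha : H b ≤ suc (H a)
  Hb≤1+Ha = m≤n⇒m≤1+n Hb≤Ha

  module C→A = UnitTransfer {T} c<Z a<Z (a≢c ∘ sym) (λ z z≢c z≢a → sym (H-off z z≢a z≢c))
                 (trans Fc (cong suc (sym Hc))) Ha (≤-<-trans (n≤1+n (F a)) Fa<T)

  H≗G : ∀ z → z ≢ b → z ≢ a → H z ≡ G z
  H≗G z z≢b z≢a = by-cases (z ≟ c)
    where
    by-cases : Dec (z ≡ c) → H z ≡ G z
    by-cases (yes refl) = Hc
    by-cases (no  z≢c)  = trans (H-off z z≢a z≢c) (agree z z≢a z≢b z≢c)

  module B→A = UnitTransfer {T} b<Z a<Z (a≢b ∘ sym) H≗G
                 (trans Hb Fb) (trans Ga (cong suc (sym Ha))) (subst (_< T) (sym Ha) Fa<T)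

  strict : ∃ λ k → psumᶠ T Z F k < psumᶠ T Z G k
  strict = Data.Product.map₂ (λ {k} → ≤-<-trans (C→A.psumᶠ-mono Fc≤ k)) (B→A.psumᶠ-strict Hb≤Ha)

-- ℤ's prefix +_ is opened only here, since it makes ℕ sections such as (n +_) ambiguous.
module _ where

  open import Data.Integer using (+_; ∣_∣)

  fixed-beyond-bound : ∀ u x → bound u < ∣ fun u x ∣ → fun u x ≡ x
  fixed-beyond-bound u x b<∣ux∣ = begin
    fun u x                        ≡⟨ inv-l u (fun u x) ⟨
    inv u (fun u (fun u x))        ≡⟨ cong (inv u) (supp u (fun u x) b<∣ux∣) ⟩
    inv u (fun u x)                ≡⟨ inv-l u x ⟩
    x                              ∎
    where open ≡-Reasoning

  no-inversion-beyond-bound : ∀ u {i j} → bound u < j → i < j → ¬ (fun u (+ j) ℤ.< fun u (+ i))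
  no-inversion-beyond-bound u {i} {j} b<j i<j uj<ui =
    larger-image (fun u (+ i)) refl (subst (ℤ._< fun u (+ i)) (supp u (+ j) b<j) uj<ui)
    where
    larger-image : ∀ y → fun u (+ i) ≡ y → + j ℤ.< y → ⊥
    larger-image (+ n) ui≡n (+<+ j<n) = <-asym i<j (subst (j <_) (ℤP.+-injective n≡i) j<n)
      where
      n≡i : + n ≡ + i
      n≡i = trans (sym ui≡n) (fixed-beyond-bound u (+ i) (subst (λ y → bound u < ∣ y ∣) (sym ui≡n) (<-trans b<j j<n)))

  inversion : Perm → ℕ → ℕ → ℕ
  inversion u i j = 𝟙 (i <? j) * 𝟙 (fun u (+ j) ℤ.<? fun u (+ i))

  inversion-≮ : ∀ u {i j} → ¬ i < j → inversion u i j ≡ 0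
  inversion-≮ u {i} {j} i≮j rewrite 𝟙-no i≮j (i <? j) = refl

  inversion-< : ∀ u {i j} → i < j → inversion u i j ≡ 𝟙 (fun u (+ j) ℤ.<? fun u (+ i))
  inversion-< u {i} {j} i<j rewrite 𝟙-yes i<j (i <? j) = +-identityʳ _

  inversion-cong : ∀ u u′ {i j} → (i < j → fun u (+ j) ℤ.< fun u (+ i) → fun u′ (+ j) ℤ.< fun u′ (+ i))
                                 → (i < j → fun u′ (+ j) ℤ.< fun u′ (+ i) → fun u (+ j) ℤ.< fun u (+ i))
                                 → inversion u i j ≡ inversion u′ i j
  inversion-cong u u′ {i} {j} to from with i <? j
  ... | yes i<j = cong (1 *_) (𝟙-cong (to i<j) (from i<j) _ _)
  ... | no  _   = refl

  inversion-mono-row : ∀ u {i i′ j} → i′ ≤ i →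
                       (fun u (+ j) ℤ.< fun u (+ i) → fun u (+ j) ℤ.< fun u (+ i′)) →
                       inversion u i j ≤ inversion u i′ j
  inversion-mono-row u {i} {i′} {j} i′≤i below =
    *-mono-≤ (𝟙-mono (≤-<-trans i′≤i) (i <? j) (i′ <? j)) (𝟙-mono below _ _)

  codeEntry-∑ : ∀ u i {M} → i + bound u < M → codeEntry u i ≡ ∑[ j < M ] inversion u i j
  codeEntry-∑ u i {M} i+b<M = begin
    codeEntry u i
      ≡⟨ cong (length ∘ filter P?) (List.map-upTo (λ k → suc i + k) n) ⟩
    length (filter P? (applyUpTo (λ k → suc i + k) n))
      ≡⟨ length-filter-applyUpTo P? (λ k → suc i + k) n ⟩
    ∑[ k < n ] 𝟙 (P? (suc i + k))
      ≡⟨ ∑-cong n (λ k _ → inversion-< u (s≤s (m≤m+n i k))) ⟨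
    ∑[ k < n ] inversion u i (suc i + k)
      ≡⟨ cong (_+ (∑[ k < n ] inversion u i (suc i + k))) (∑-zero (suc i) (λ j → inversion-≮ u ∘ ≤⇒≯ ∘ ℕ.s≤s⁻¹)) ⟨
    (∑[ j < suc i ] inversion u i j) + (∑[ k < n ] inversion u i (suc i + k))
      ≡⟨ ∑-++ (suc i) n (inversion u i) ⟨
    ∑[ j < suc i + n ] inversion u i j
      ≡⟨ ∑-trailing-zeros (inversion u i) (≤-trans (s≤s (+-monoʳ-≤ i (m∸n≤m (bound u) i))) i+b<M) tail ⟨
    ∑[ j < M ] inversion u i j
      ∎
    where
    open ≡-Reasoning
    n = bound u ∸ i
    P? = λ j → fun u (+ j) ℤ.<? fun u (+ i)
    tail : ∀ j → suc i + n ≤ j → inversion u i j ≡ 0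
    tail j n≤j = trans (inversion-< u i<j) (𝟙-no (no-inversion-beyond-bound u b<j i<j) (P? j))
      where
      i<j : i < j
      i<j = ≤-trans (s≤s (m≤m+n i n)) n≤j
      b<j : bound u < j
      b<j = ≤-trans (s≤s (m≤n+m∸n (bound u) i)) n≤j

  codeEntry-≤-bound : ∀ u i → codeEntry u i ≤ bound u
  codeEntry-≤-bound u i = begin
    codeEntry u i                         ≤⟨ List.length-filter (λ j → fun u (+ j) ℤ.<? fun u (+ i)) later ⟩
    length later                          ≡⟨ List.length-map (λ k → suc i + k) (upTo (bound u ∸ i)) ⟩
    length (upTo (bound u ∸ i))           ≡⟨ List.length-upTo (bound u ∸ i) ⟩
    bound u ∸ i                           ≤⟨ m∸n≤m (bound u) i ⟩
    bound u                               ∎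
    where
    open ≤-Reasoning
    later = map (λ k → suc i + k) (upTo (bound u ∸ i))

  codeEntry-beyond-bound : ∀ u i → bound u ≤ i → codeEntry u i ≡ 0
  codeEntry-beyond-bound u i b≤i rewrite m≤n⇒m∸n≡0 b≤i = refl

  -- c_{z+1}(u), i.e. the code indexed from 0.
  codeᶠ : Perm → ℕ → ℕ
  codeᶠ u z = codeEntry u (suc z)

  module _ (u : Perm) {Z : ℕ} (b≤Z : bound u ≤ Z) where

    private
      code≡applyUpTo : code u ≡ applyUpTo (codeᶠ u) (bound u)
      code≡applyUpTo = List.map-upTo (codeᶠ u) (bound u)

      codeᶠ-tail : ∀ z → bound u ≤ z → codeᶠ u z ≡ 0
      codeᶠ-tail z b≤z = codeEntry-beyond-bound u (suc z) (m≤n⇒m≤1+n b≤z)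

    sum-shape : sum (shape u) ≡ ∑ Z (codeᶠ u)
    sum-shape rewrite code≡applyUpTo = sum-sortDesc-applyUpTo (codeᶠ u) b≤Z codeᶠ-tail

    psum-shape : ∀ {T} → Z ≤ T → ∀ k → psum k (shape u) ≡ psumᶠ T Z (codeᶠ u) k
    psum-shape Z≤T rewrite code≡applyUpTo =
      psum-sortDesc-applyUpTo (codeᶠ u) b≤Z codeᶠ-tail (λ z → ≤-trans (codeEntry-≤-bound u (suc z)) (≤-trans b≤Z Z≤T))

  shape-◁ : ∀ v w {Z T} → bound v ≤ Z → bound w ≤ Z → Z ≤ T →
            codeᶠ v ◁⟨ T , Z ⟩ codeᶠ w → shape v ◁ shape w
  shape-◁ v w bv≤Z bw≤Z Z≤T (∑≡∑ , psum≤psum , k , psum<psum) =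
    trans (sum-shape v bv≤Z) (trans ∑≡∑ (sym (sum-shape w bw≤Z))) ,
    (λ k → subst₂ _≤_ (sym (psum-shape v bv≤Z Z≤T k)) (sym (psum-shape w bw≤Z Z≤T k)) (psum≤psum k)) ,
    k , subst₂ _<_ (sym (psum-shape v bv≤Z Z≤T k)) (sym (psum-shape w bw≤Z Z≤T k)) psum<psum

  -- The entries p, …, p + 3 of v⁻¹ are a d b c and those of w⁻¹ are b c a d, where a = 1 + za etc.
  module ElementaryStep (v w : Perm) (p : ℤ) {za zb zc zd : ℕ} (za<zb : za < zb) (zb<zc : zb < zc) (zc<zd : zc < zd)
    (va : fun v (+ suc za) ≡ p ℤ.+ + 0) (vd : fun v (+ suc zd) ≡ p ℤ.+ + 1)
    (vb : fun v (+ suc zb) ≡ p ℤ.+ + 2) (vc : fun v (+ suc zc) ≡ p ℤ.+ + 3)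
    (wb : fun w (+ suc zb) ≡ p ℤ.+ + 0) (wc : fun w (+ suc zc) ≡ p ℤ.+ + 1)
    (wa : fun w (+ suc za) ≡ p ℤ.+ + 2) (wd : fun w (+ suc zd) ≡ p ℤ.+ + 3)
    (w≡v-off-block : ∀ j → fun v (+ j) ℤ.< p ℤ.+ + 0 ⊎ p ℤ.+ + 3 ℤ.< fun v (+ j) → fun w (+ j) ≡ fun v (+ j))
    where

    a b c d : ℕ
    a = suc za
    b = suc zb
    c = suc zc
    d = suc zd

    a<b : a < b
    a<b = s≤s za<zb
    b<c : b < c
    b<c = s≤s zb<zc
    c<d : c < d
    c<d = s≤s zc<zd

    infix 8 p+_
    p+_ : ℕ → ℤ
    p+ m = p ℤ.+ + m

    OffBlock : ℤ → Set
    OffBlock y = y ℤ.< p+ 0 ⊎ p+ 3 ℤ.< y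

    p+-mono-≤ : ∀ {m n} → m ≤ n → p+ m ℤ.≤ p+ n
    p+-mono-≤ m≤n = ℤP.+-monoʳ-≤ p (+≤+ m≤n)

    𝟙-p+-< : ∀ m n → 𝟙 (p+ m ℤ.<? p+ n) ≡ 𝟙 (m <? n)
    𝟙-p+-< m n = 𝟙-cong (λ lt → ≰⇒> (ℤP.<⇒≱ lt ∘ p+-mono-≤)) (λ m<n → ℤP.+-monoʳ-< p (+<+ m<n)) _ _

    p+-not-off-block : ∀ {m} → m ≤ 3 → ¬ OffBlock (p+ m)
    p+-not-off-block m≤3 (inj₁ lt) = ℤP.<⇒≱ lt (p+-mono-≤ z≤n)
    p+-not-off-block m≤3 (inj₂ lt) = ℤP.<⇒≱ lt (p+-mono-≤ m≤3)

    off-block-below : ∀ {y m n} → OffBlock y → m ≤ 3 → n ≤ 3 → y ℤ.< p+ m → y ℤ.< p+ n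
    off-block-below (inj₁ y<p) _ _ _ = ℤP.<-≤-trans y<p (p+-mono-≤ z≤n)
    off-block-below (inj₂ p+3<y) m≤3 _ y<p+m = ⊥-elim (ℤP.<-asym y<p+m (ℤP.≤-<-trans (p+-mono-≤ m≤3) p+3<y))

    off-block-above : ∀ {y m n} → OffBlock y → m ≤ 3 → n ≤ 3 → p+ m ℤ.< y → p+ n ℤ.< y
    off-block-above (inj₁ y<p) _ _ p+m<y = ⊥-elim (ℤP.<-asym p+m<y (ℤP.<-≤-trans y<p (p+-mono-≤ z≤n)))
    off-block-above (inj₂ p+3<y) _ n≤3 _ = ℤP.≤-<-trans (p+-mono-≤ n≤3) p+3<y

    block-or-off : ∀ y → OffBlock y ⊎ Σ[ m ∈ ℕ ] m ≤ 3 × y ≡ p+ m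
    block-or-off y = split (y ℤ.- p) (sym (y≡p+[y-p]))
      where
      y≡p+[y-p] : p ℤ.+ (y ℤ.- p) ≡ y
      y≡p+[y-p] = trans (sym (ℤP.+-assoc p y (ℤ.- p))) (xyx⁻¹≈y p y)
      split : ∀ e → y ≡ p ℤ.+ e → OffBlock y ⊎ Σ[ m ∈ ℕ ] m ≤ 3 × y ≡ p+ m
      split -[1+ n ] refl = inj₁ (inj₁ (ℤP.+-monoʳ-< p -<+))
      split (+ m) y≡p+m with m ≤? 3
      ... | yes m≤3 = inj₂ (m , m≤3 , y≡p+m)
      ... | no  m≰3 = inj₁ (inj₂ (subst (p+ 3 ℤ.<_) (sym y≡p+m) (ℤP.+-monoʳ-< p (+<+ (≰⇒> m≰3)))))

    data Position (j : ℕ) : Set where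
      off-block : OffBlock (fun v (+ j)) → Position j
      at-a : j ≡ a → Position j
      at-b : j ≡ b → Position j
      at-c : j ≡ c → Position j
      at-d : j ≡ d → Position j

    v-injective : ∀ {i j} → fun v (+ i) ≡ fun v (+ j) → i ≡ j
    v-injective {i} {j} vi≡vj =
      ℤP.+-injective (trans (sym (inv-l v (+ i))) (trans (cong (inv v) vi≡vj) (inv-l v (+ j))))

    position : ∀ j → Position j
    position j with block-or-off (fun v (+ j))
    ... | inj₁ off             = off-block off
    ... | inj₂ (0 , _ , vj≡p)  = at-a (v-injective (trans vj≡p (sym va)))
    ... | inj₂ (1 , _ , vj≡p)  = at-d (v-injective (trans vj≡p (sym vd)))
    ... | inj₂ (2 , _ , vj≡p)  = at-b (v-injective (trans vj≡p (sym vb)))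
    ... | inj₂ (3 , _ , vj≡p)  = at-c (v-injective (trans vj≡p (sym vc)))
    ... | inj₂ (suc (suc (suc (suc _))) , s≤s (s≤s (s≤s ())) , _)

    infix 4 _∼_
    data _∼_ : ℤ → ℤ → Set where
      same     : ∀ {x} → x ∼ x
      in-block : ∀ {m n} → m ≤ 3 → n ≤ 3 → p+ m ∼ p+ n

    ∼-sym : ∀ {x x′} → x ∼ x′ → x′ ∼ x
    ∼-sym same              = same
    ∼-sym (in-block m≤3 n≤3) = in-block n≤3 m≤3

    off-block-below-∼ : ∀ {y x x′} → OffBlock y → x ∼ x′ → y ℤ.< x → y ℤ.< x′
    off-block-below-∼ off same               = Function.id
    off-block-below-∼ off (in-block m≤3 n≤3) = off-block-below off m≤3 n≤3

    off-block-above-∼ : ∀ {y x x′} → OffBlock y → x ∼ x′ → x ℤ.< y → x′ ℤ.< y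
    off-block-above-∼ off same               = Function.id
    off-block-above-∼ off (in-block m≤3 n≤3) = off-block-above off m≤3 n≤3

    v∼w : ∀ j → fun v (+ j) ∼ fun w (+ j)
    v∼w j with position j
    ... | off-block off = subst (fun v (+ j) ∼_) (sym (w≡v-off-block j off)) same
    ... | at-a refl = subst₂ _∼_ (sym va) (sym wa) (in-block z≤n (s≤s (s≤s z≤n)))
    ... | at-b refl = subst₂ _∼_ (sym vb) (sym wb) (in-block (s≤s (s≤s z≤n)) z≤n)
    ... | at-c refl = subst₂ _∼_ (sym vc) (sym wc) (in-block ≤-refl (s≤s z≤n))
    ... | at-d refl = subst₂ _∼_ (sym vd) (sym wd) (in-block (s≤s z≤n) ≤-refl)

    inversion-unchanged-col : ∀ i {j} → OffBlock (fun v (+ j)) → inversion w i j ≡ inversion v i j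
    inversion-unchanged-col i {j} off = inversion-cong w v
      (λ _ wj<wi → off-block-below-∼ off (∼-sym (v∼w i)) (subst (ℤ._< fun w (+ i)) wj≡vj wj<wi))
      (λ _ vj<vi → subst (ℤ._< fun w (+ i)) (sym wj≡vj) (off-block-below-∼ off (v∼w i) vj<vi))
      where
      wj≡vj = w≡v-off-block j off

    inversion-unchanged-row : ∀ {i} j → OffBlock (fun v (+ i)) → inversion w i j ≡ inversion v i j
    inversion-unchanged-row {i} j off = inversion-cong w v
      (λ _ wj<wi → off-block-above-∼ off (∼-sym (v∼w j)) (subst (fun w (+ j) ℤ.<_) wi≡vi wj<wi))
      (λ _ vj<vi → subst (fun w (+ j) ℤ.<_) (sym wi≡vi) (off-block-above-∼ off (v∼w j) vj<vi))
      where
      wi≡vi = w≡v-off-block i off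

    inversion-in-block : ∀ u {i j m n} → i < j → fun u (+ i) ≡ p+ m → fun u (+ j) ≡ p+ n →
                         inversion u i j ≡ 𝟙 (n <? m)
    inversion-in-block u i<j ui≡p+m uj≡p+n =
      trans (inversion-< u i<j) (trans (cong₂ (λ x y → 𝟙 (x ℤ.<? y)) uj≡p+n ui≡p+m) (𝟙-p+-< _ _))

    off-block-≢ : ∀ {j k m} → OffBlock (fun v (+ j)) → m ≤ 3 → fun v (+ k) ≡ p+ m → j ≢ k
    off-block-≢ off m≤3 vk≡p+m refl = p+-not-off-block m≤3 (subst OffBlock vk≡p+m off)

    a<c : a < c
    a<c = <-trans a<b b<c
    b<d : b < d
    b<d = <-trans b<c c<d
    a<d : a < d
    a<d = <-trans a<c c<d

    inversion-row-a : ∀ j → inversion w a j ≡ inversion v a j + δ j b + δ j c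
    inversion-row-a j with position j
    ... | off-block off rewrite inversion-unchanged-col a off
          | δ-≢ (off-block-≢ off (s≤s (s≤s z≤n)) vb) | δ-≢ (off-block-≢ off ≤-refl vc) =
          sym (trans (+-identityʳ _) (+-identityʳ _))
    ... | at-a refl rewrite inversion-≮ w {a} {a} (<-irrefl refl) | inversion-≮ v {a} {a} (<-irrefl refl)
          | δ-≢ (<⇒≢ a<b) | δ-≢ (<⇒≢ a<c) = refl
    ... | at-b refl rewrite inversion-in-block w a<b wa wb | inversion-in-block v a<b va vb
          | δ-refl b | δ-≢ (<⇒≢ b<c) = refl
    ... | at-c refl rewrite inversion-in-block w a<c wa wc | inversion-in-block v a<c va vc
          | δ-≢ (>⇒≢ b<c) | δ-refl c = refl
    ... | at-d refl rewrite inversion-in-block w a<d wa wd | inversion-in-block v a<d va vd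
          | δ-≢ (>⇒≢ b<d) | δ-≢ (>⇒≢ c<d) = refl

    inversion-row-below-d : ∀ {i j} → j ≤ i → j ≢ d → inversion v i j ≡ inversion w i j + δ j d
    inversion-row-below-d {i} {j} j≤i j≢d
      rewrite inversion-≮ v {i} {j} (≤⇒≯ j≤i) | inversion-≮ w {i} {j} (≤⇒≯ j≤i) | δ-≢ j≢d = refl

    inversion-row-b : ∀ j → inversion v b j ≡ inversion w b j + δ j d
    inversion-row-b j with position j
    ... | off-block off rewrite inversion-unchanged-col b off | δ-≢ (off-block-≢ off (s≤s z≤n) vd) =
          sym (+-identityʳ _)
    ... | at-a refl = inversion-row-below-d (<⇒≤ a<b) (<⇒≢ a<d)
    ... | at-b refl = inversion-row-below-d {b} ≤-refl (<⇒≢ b<d)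
    ... | at-c refl rewrite inversion-in-block v b<c vb vc | inversion-in-block w b<c wb wc | δ-≢ (<⇒≢ c<d) = refl
    ... | at-d refl rewrite inversion-in-block v b<d vb vd | inversion-in-block w b<d wb wd | δ-refl d = refl

    inversion-row-c : ∀ j → inversion v c j ≡ inversion w c j + δ j d
    inversion-row-c j with position j
    ... | off-block off rewrite inversion-unchanged-col c off | δ-≢ (off-block-≢ off (s≤s z≤n) vd) =
          sym (+-identityʳ _)
    ... | at-a refl = inversion-row-below-d (<⇒≤ a<c) (<⇒≢ a<d)
    ... | at-b refl = inversion-row-below-d (<⇒≤ b<c) (<⇒≢ b<d)
    ... | at-c refl = inversion-row-below-d {c} ≤-refl (<⇒≢ c<d)
    ... | at-d refl rewrite inversion-in-block v c<d vc vd | inversion-in-block w c<d wc wd | δ-refl d = refl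

    inversion-unchanged-≤ : ∀ {i j} → j ≤ i → inversion w i j ≡ inversion v i j
    inversion-unchanged-≤ j≤i = trans (inversion-≮ w (≤⇒≯ j≤i)) (sym (inversion-≮ v (≤⇒≯ j≤i)))

    inversion-other-row : ∀ i → i ≢ a → i ≢ b → i ≢ c → ∀ j → inversion w i j ≡ inversion v i j
    inversion-other-row i i≢a i≢b i≢c j with position i
    ... | off-block off = inversion-unchanged-row j off
    ... | at-a i≡a = ⊥-elim (i≢a i≡a)
    ... | at-b i≡b = ⊥-elim (i≢b i≡b)
    ... | at-c i≡c = ⊥-elim (i≢c i≡c)
    ... | at-d refl with position j
    ...   | off-block off = inversion-unchanged-col d off
    ...   | at-a refl = inversion-unchanged-≤ (<⇒≤ a<d)
    ...   | at-b refl = inversion-unchanged-≤ (<⇒≤ b<d)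
    ...   | at-c refl = inversion-unchanged-≤ (<⇒≤ c<d)
    ...   | at-d refl = inversion-unchanged-≤ {d} ≤-refl

    off-block-below-a : ∀ {i j m} → OffBlock (fun v (+ j)) → m ≤ 3 → fun v (+ i) ≡ p+ m →
                        fun v (+ j) ℤ.< fun v (+ i) → fun v (+ j) ℤ.< fun v (+ a)
    off-block-below-a {j = j} off m≤3 vi≡p+m vj<vi = subst (fun v (+ j) ℤ.<_) (sym va)
      (off-block-below off m≤3 z≤n (subst (fun v (+ j) ℤ.<_) vi≡p+m vj<vi))

    inversion-row-b-≤ : ∀ j → inversion v b j ≤ inversion v a j + δ j d
    inversion-row-b-≤ j with position j
    ... | off-block off =
          ≤-trans (inversion-mono-row v (<⇒≤ a<b) (off-block-below-a off (s≤s (s≤s z≤n)) vb)) (m≤m+n _ _)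
    ... | at-a refl rewrite inversion-≮ v {b} {a} (<-asym a<b) = z≤n
    ... | at-b refl rewrite inversion-≮ v {b} {b} (<-irrefl refl) = z≤n
    ... | at-c refl rewrite inversion-in-block v b<c vb vc = z≤n
    ... | at-d refl rewrite inversion-in-block v b<d vb vd | δ-refl d = m≤n+m 1 _

    inversion-row-c-≤ : ∀ j → inversion v c j ≤ inversion v a j + δ j d
    inversion-row-c-≤ j with position j
    ... | off-block off =
          ≤-trans (inversion-mono-row v (<⇒≤ a<c) (off-block-below-a off ≤-refl vc)) (m≤m+n _ _)
    ... | at-a refl rewrite inversion-≮ v {c} {a} (<-asym a<c) = z≤n
    ... | at-b refl rewrite inversion-≮ v {c} {b} (<-asym b<c) = z≤n
    ... | at-c refl rewrite inversion-≮ v {c} {c} (<-irrefl refl) = z≤n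
    ... | at-d refl rewrite inversion-in-block v c<d vc vd | δ-refl d = m≤n+m 1 _

    private
      M : ℕ → ℕ
      M i = suc (i + (bound v + bound w))

      codeEntry-v-∑ : ∀ {i k} → i ≤ k → codeEntry v i ≡ ∑[ j < M k ] inversion v i j
      codeEntry-v-∑ i≤k = codeEntry-∑ v _ (s≤s (+-mono-≤ i≤k (m≤m+n (bound v) (bound w))))

      codeEntry-w-∑ : ∀ {i k} → i ≤ k → codeEntry w i ≡ ∑[ j < M k ] inversion w i j
      codeEntry-w-∑ i≤k = codeEntry-∑ w _ (s≤s (+-mono-≤ i≤k (m≤n+m (bound w) (bound v))))

      b<M : b < M d
      b<M = s≤s (≤-trans (<⇒≤ b<d) (m≤m+n d _))

      c<M : c < M d
      c<M = s≤s (≤-trans (<⇒≤ c<d) (m≤m+n d _))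

      d<M : d < M d
      d<M = s≤s (m≤m+n d _)

    codeEntry-a : codeEntry w a ≡ codeEntry v a + 2
    codeEntry-a = begin
      codeEntry w a                                  ≡⟨ codeEntry-w-∑ (<⇒≤ a<d) ⟩
      ∑[ j < M d ] inversion w a j                   ≡⟨ ∑-+-δ (M d) c<M inversion-row-a ⟩
      (∑[ j < M d ] (inversion v a j + δ j b)) + 1   ≡⟨ cong (_+ 1) (∑-+-δ (M d) {g = inversion v a} b<M λ _ → refl) ⟩
      (∑[ j < M d ] inversion v a j) + 1 + 1         ≡⟨ +-assoc _ 1 1 ⟩
      (∑[ j < M d ] inversion v a j) + 2             ≡⟨ cong (_+ 2) (codeEntry-v-∑ (<⇒≤ a<d)) ⟨
      codeEntry v a + 2                              ∎
      where open ≡-Reasoning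

    codeEntry-b : codeEntry v b ≡ codeEntry w b + 1
    codeEntry-b = begin
      codeEntry v b                          ≡⟨ codeEntry-v-∑ (<⇒≤ b<d) ⟩
      ∑[ j < M d ] inversion v b j           ≡⟨ ∑-+-δ (M d) d<M inversion-row-b ⟩
      (∑[ j < M d ] inversion w b j) + 1     ≡⟨ cong (_+ 1) (codeEntry-w-∑ (<⇒≤ b<d)) ⟨
      codeEntry w b + 1                      ∎
      where open ≡-Reasoning

    codeEntry-c : codeEntry v c ≡ codeEntry w c + 1
    codeEntry-c = begin
      codeEntry v c                          ≡⟨ codeEntry-v-∑ (<⇒≤ c<d) ⟩
      ∑[ j < M d ] inversion v c j           ≡⟨ ∑-+-δ (M d) d<M inversion-row-c ⟩
      (∑[ j < M d ] inversion w c j) + 1     ≡⟨ cong (_+ 1) (codeEntry-w-∑ (<⇒≤ c<d)) ⟨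
      codeEntry w c + 1                      ∎
      where open ≡-Reasoning

    codeEntry-other : ∀ i → i ≢ a → i ≢ b → i ≢ c → codeEntry w i ≡ codeEntry v i
    codeEntry-other i i≢a i≢b i≢c = begin
      codeEntry w i                  ≡⟨ codeEntry-w-∑ {i} ≤-refl ⟩
      ∑[ j < M i ] inversion w i j   ≡⟨ ∑-cong (M i) (λ j _ → inversion-other-row i i≢a i≢b i≢c j) ⟩
      ∑[ j < M i ] inversion v i j   ≡⟨ codeEntry-v-∑ {i} ≤-refl ⟨
      codeEntry v i                  ∎
      where open ≡-Reasoning

    codeEntry-b-≤ : codeEntry v b ≤ codeEntry v a + 1
    codeEntry-b-≤ = begin
      codeEntry v b                          ≡⟨ codeEntry-v-∑ (<⇒≤ b<d) ⟩
      ∑[ j < M d ] inversion v b j           ≤⟨ ∑-≤-+-δ (M d) d<M inversion-row-b-≤ ⟩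
      (∑[ j < M d ] inversion v a j) + 1     ≡⟨ cong (_+ 1) (codeEntry-v-∑ (<⇒≤ a<d)) ⟨
      codeEntry v a + 1                      ∎
      where open ≤-Reasoning

    codeEntry-c-≤ : codeEntry v c ≤ codeEntry v a + 1
    codeEntry-c-≤ = begin
      codeEntry v c                          ≡⟨ codeEntry-v-∑ (<⇒≤ c<d) ⟩
      ∑[ j < M d ] inversion v c j           ≤⟨ ∑-≤-+-δ (M d) d<M inversion-row-c-≤ ⟩
      (∑[ j < M d ] inversion v a j) + 1     ≡⟨ cong (_+ 1) (codeEntry-v-∑ (<⇒≤ a<d)) ⟨
      codeEntry v a + 1                      ∎
      where open ≤-Reasoning

    private
      Z : ℕ
      Z = suc (zd + (bound v + bound w))

      bv≤Z : bound v ≤ Z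
      bv≤Z = m≤n⇒m≤1+n (≤-trans (m≤m+n (bound v) (bound w)) (m≤n+m _ zd))

      bw≤Z : bound w ≤ Z
      bw≤Z = m≤n⇒m≤1+n (≤-trans (m≤n+m (bound w) (bound v)) (m≤n+m _ zd))

      zd<Z : zd < Z
      zd<Z = s≤s (m≤m+n zd _)

    codeᶠ-◁ : codeᶠ v ◁⟨ suc (suc Z) , Z ⟩ codeᶠ w
    codeᶠ-◁ = double-transfer za<Z zb<Z zc<Z (<⇒≢ za<zb) (<⇒≢ (<-trans za<zb zb<zc)) (<⇒≢ zb<zc)
      (λ z z≢a z≢b z≢c → sym (codeEntry-other (suc z) (z≢a ∘ suc-injective) (z≢b ∘ suc-injective)
                                                      (z≢c ∘ suc-injective)))
      (trans codeEntry-a (+-comm _ 2)) (trans codeEntry-b (+-comm _ 1)) (trans codeEntry-c (+-comm _ 1))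
      (subst (codeᶠ v zb ≤_) (+-comm (codeᶠ v za) 1) codeEntry-b-≤)
      (subst (codeᶠ v zc ≤_) (+-comm (codeᶠ v za) 1) codeEntry-c-≤)
      (s≤s (s≤s (≤-trans (codeEntry-≤-bound v a) bv≤Z)))
      where
      zc<Z = <-trans zc<zd zd<Z
      zb<Z = <-trans zb<zc zc<Z
      za<Z = <-trans za<zb zb<Z

    shape-v◁shape-w : shape v ◁ shape w
    shape-v◁shape-w = shape-◁ v w bv≤Z bw≤Z (≤-trans (n≤1+n Z) (n≤1+n (suc Z))) codeᶠ-◁

  preimage-positive : ∀ u → InS∞ u → ∀ y {n} → y ≡ + suc n → Σ[ k ∈ ℕ ] inv u y ≡ + suc k
  preimage-positive u u∈S∞ y y≡1+n = positive (inv u y) (inv-r u y)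
    where
    positive : ∀ x → fun u x ≡ y → Σ[ k ∈ ℕ ] x ≡ + suc k
    positive (+ suc k) _    = k , refl
    positive (+ zero)  ux≡y with () ← trans (trans (sym (u∈S∞ _ (+≤+ z≤n))) ux≡y) y≡1+n
    positive -[1+ _ ]  ux≡y with () ← trans (trans (sym (u∈S∞ _ -≤+)) ux≡y) y≡1+n

  fun-inv : ∀ u {x y} → inv u y ≡ x → fun u x ≡ y
  fun-inv u {y = y} inv-y≡x = trans (cong (fun u) (sym inv-y≡x)) (inv-r u y)

  step-◁ : ∀ v w → Step v w → shape v ◁ shape w
  step-◁ v w (v∈S∞ , _ , m , a<b , b<c , c<d , w⁻¹p≡b , w⁻¹p+1≡c , w⁻¹p+2≡a , w⁻¹p+3≡d , w⁻¹≡v⁻¹) =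
    ElementaryStep.shape-v◁shape-w v w p
      (⟨+⟩ (subst₂ ℤ._<_ (proj₂ pA) (proj₂ pB) a<b))
      (⟨+⟩ (subst₂ ℤ._<_ (proj₂ pB) (proj₂ pC) b<c))
      (⟨+⟩ (subst₂ ℤ._<_ (proj₂ pC) (proj₂ pD) c<d))
      (trans (fun-inv v (proj₂ pA)) p≡p+0) (fun-inv v (proj₂ pD)) (fun-inv v (proj₂ pB)) (fun-inv v (proj₂ pC))
      (trans (fun-inv w (trans w⁻¹p≡b (proj₂ pB))) p≡p+0) (fun-inv w (trans w⁻¹p+1≡c (proj₂ pC)))
      (fun-inv w (trans w⁻¹p+2≡a (proj₂ pA))) (fun-inv w (trans w⁻¹p+3≡d (proj₂ pD)))
      off-block
    where
    p : ℤ
    p = + suc (2 * m)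
    pA = preimage-positive v v∈S∞ p refl
    pD = preimage-positive v v∈S∞ (p ℤ.+ + 1) refl
    pB = preimage-positive v v∈S∞ (p ℤ.+ + 2) refl
    pC = preimage-positive v v∈S∞ (p ℤ.+ + 3) refl
    ⟨+⟩ : ∀ {x y} → + suc x ℤ.< + suc y → x < y
    ⟨+⟩ = ℕ.s≤s⁻¹ ∘ ℤP.drop‿+<+
    p≡p+0 : p ≡ p ℤ.+ + 0
    p≡p+0 = sym (ℤP.+-identityʳ p)
    off-block : ∀ j → fun v (+ j) ℤ.< p ℤ.+ + 0 ⊎ p ℤ.+ + 3 ℤ.< fun v (+ j) → fun w (+ j) ≡ fun v (+ j)
    off-block j off = fun-inv w (trans (w⁻¹≡v⁻¹ vj (Data.Sum.map₁ (subst (vj ℤ.<_) (sym p≡p+0)) off)) (inv-l v (+ j)))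
      where vj = fun v (+ j)

◁-trans : ∀ {μ ν ρ} → μ ◁ ν → ν ◁ ρ → μ ◁ ρ
◁-trans (∑₁≡∑₂ , ≤₁₂ , k , <₁₂) (∑₂≡∑₃ , ≤₂₃ , _) =
  trans ∑₁≡∑₂ ∑₂≡∑₃ , (λ k → ≤-trans (≤₁₂ k) (≤₂₃ k)) , k , <-≤-trans <₁₂ (≤₂₃ k)

<AFPF⇒◁ : ∀ {v w} → v <AFPF w → shape v ◁ shape w
<AFPF⇒◁ {v} {w} [ step ]            = step-◁ v w step
<AFPF⇒◁ {v} (_∷_ {y = u} step steps) = ◁-trans (step-◁ v u step) (<AFPF⇒◁ steps)

lemma3p46 : (z : ℤ → ℤ) → InF∞ z → (v w : Perm) →
    InAFPF z v → InAFPF z w → v <AFPF w → shape v ◁ shape w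
lemma3p46 _ _ _ _ _ _ = <AFPF⇒◁
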